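{- Let $G=(A\cup B,E)$ with $|A|=|B|=n$ admit a perfect matching, and let $M$ be a perfect matching in $G$. Then $M$ is a popular assignment if and only if there exists an optimal solution $\vec\alpha$ to the linear program (LP2) $\min \sum_{u\in A\cup B} y_u$ subject to $y_a+y_b\ge \mathsf{wt}_M(a,b)$ for all $(a,b)\in E$, such that $\alpha_a\in\{0,1,\dots,n-1\}$ for all $a\in A$, $\alpha_b\in\{0,-1,\dots,-(n-1)\}$ for all $b\in B$, and $\sum_{u\in A\cup B}\alpha_u=0$.
   Context: Every agent $a\in A$ has a strict partial order $\succ_a$ over her neighbors in $B$; objects have no preferences. For a perfect matching $M$ and $(a,b)\in E$: $\mathsf{wt}_M(a,b)=1$ if $b\succ_a M(a)$, $\mathsf{wt}_M(a,b)=-1$ if $M(a)\succ_a b$, and $0$ otherwise. For matchings $M,N$, agent $a$ prefers $M$ to $N$ if $a$ is matched in $M$ and either unmatched in $N$ or $M(a)\succ_a N(a)$; $\phi(M,N)$ counts agents preferring $M$ to $N$ and $\Delta(M,N)=\phi(M,N)-\phi(N,M)$. A popular assignment is a perfect matching $M$ with $\Delta(M,N)\ge 0$ for all perfect matchings $N$.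
   Formalization: Optimality of $\vec\alpha$ for (LP2) is tested only against feasible solutions whose values are rational. -}

module Defs where

open import Data.Nat using (ℕ; zero; suc)
open import Data.Bool using (Bool; true; false; if_then_else_)
open import Data.Fin using (Fin; zero; suc)
open import Data.Integer as ℤ using (ℤ; +_; -_; _-_)
open import Data.Rational as ℚ using (ℚ; _/_)
open import Data.Product using (_×_; Σ)
open import Relation.Binary.PropositionalEquality using (_≡_)
open import Function.Definitions using (Injective)

-- Agents A = Fin n, objects B = Fin n (so |A| = |B| = n).
-- Edge set E ⊆ A × B given as a Boolean adjacency function.
Graph : ℕ → Set
Graph n = Fin n → Fin n → Bool

-- Preferences: Pref n, with  pr a b b′ ≡ true  meaning  b ≻_a b′.
Pref : ℕ → Set
Pref n = Fin n → Fin n → Fin n → Bool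

record IsPrefSystem {n : ℕ} (E : Graph n) (pr : Pref n) : Set where
  field
    onNeighbours : ∀ a b b′ → pr a b b′ ≡ true → (E a b ≡ true) × (E a b′ ≡ true)
    irrefl       : ∀ a b → pr a b b ≡ false
    trans        : ∀ a b c d → pr a b c ≡ true → pr a c d ≡ true → pr a b d ≡ true

-- A perfect matching, given as the map a ↦ M(a) : A → B, which is injective
-- (hence bijective, as |A| = |B|) and uses only edges of G.
record IsPerfectMatching {n : ℕ} (E : Graph n) (M : Fin n → Fin n) : Set where
  field
    injective : Injective _≡_ _≡_ M
    edges     : ∀ a → E a (M a) ≡ true

count : {n : ℕ} → (Fin n → Bool) → ℕ
count {zero}  p = 0
count {suc n} p = (if p zero then 1 else 0) Data.Nat.+ count (λ i → p (suc i))

sumℤ : {n : ℕ} → (Fin n → ℤ) → ℤ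
sumℤ {zero}  f = + 0
sumℤ {suc n} f = f zero ℤ.+ sumℤ (λ i → f (suc i))

sumℚ : {n : ℕ} → (Fin n → ℚ) → ℚ
sumℚ {zero}  f = ℚ.0ℚ
sumℚ {suc n} f = f zero ℚ.+ sumℚ (λ i → f (suc i))

-- φ(M,N): number of agents preferring M to N (all agents are matched in both,
-- since M, N are perfect matchings).
φ : {n : ℕ} → Pref n → (Fin n → Fin n) → (Fin n → Fin n) → ℕ
φ pr M N = count (λ a → pr a (M a) (N a))

Δ : {n : ℕ} → Pref n → (Fin n → Fin n) → (Fin n → Fin n) → ℤ
Δ pr M N = (+ φ pr M N) - (+ φ pr N M)

IsPopular : {n : ℕ} → Graph n → Pref n → (Fin n → Fin n) → Set
IsPopular E pr M =
  IsPerfectMatching E M ×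
  (∀ (N : Fin n → Fin n) → IsPerfectMatching E N → (+ 0) ℤ.≤ Δ pr M N)
  where n = _

wt : {n : ℕ} → Pref n → (Fin n → Fin n) → Fin n → Fin n → ℤ
wt pr M a b =
  if pr a b (M a) then + 1
  else if pr a (M a) b then - (+ 1)
  else + 0

toℚ : ℤ → ℚ
toℚ z = z / 1

LP2Feasible : {n : ℕ} → Graph n → Pref n → (Fin n → Fin n) →
              (Fin n → ℚ) → (Fin n → ℚ) → Set
LP2Feasible E pr M yA yB =
  ∀ a b → E a b ≡ true → toℚ (wt pr M a b) ℚ.≤ (yA a ℚ.+ yB b)

LP2Objective : {n : ℕ} → (Fin n → ℚ) → (Fin n → ℚ) → ℚ
LP2Objective yA yB = sumℚ yA ℚ.+ sumℚ yB

LP2Optimal : {n : ℕ} → Graph n → Pref n → (Fin n → Fin n) →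
             (Fin n → ℚ) → (Fin n → ℚ) → Set
LP2Optimal E pr M yA yB =
  LP2Feasible E pr M yA yB ×
  (∀ zA zB → LP2Feasible E pr M zA zB →
     LP2Objective yA yB ℚ.≤ LP2Objective zA zB)

-- For a perfect matching N, Σₐ wt_M(a, N a) = −Δ(M, N). Summing the constraints of (LP2) along N
-- therefore bounds −Δ(M, N) by the objective value; taking N = M shows that every feasible solution
-- has value ≥ 0, so a feasible solution of value 0 is optimal and certifies that M is popular.
--
-- Conversely, let the exchange digraph on A have an arc a → c of weight wt_M(a, M c) whenever
-- (a, M c) ∈ E. Its cycle covers σ (loops a → a have weight 0) are exactly the perfect matchings
-- M ∘ σ, of weight −Δ(M, M ∘ σ); a simple cycle padded with loops is a cycle cover, so when M is
-- popular no simple cycle has positive weight. Then every walk weight is dominated by a simple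
-- path weight, which is < n since arc weights are ≤ 1. Bellman–Ford relaxation from 0 therefore
-- stays in [0, n), and it stabilises because each non-stable round raises Σ h by at least 1 while
-- Σ h < n². The limit h satisfies wt_M(a, M c) ≤ h a − h c on arcs, so αₐ = h a, α_{M c} = −h c is
-- a feasible solution of value 0.

module Submission where

open import Defs
import Data.Integer.Properties as ℤP
open import Algebra.Bundles using (AbelianGroup)
open import Algebra.Properties.CommutativeSemigroup ℤP.+-commutativeSemigroup
  using (xy∙z≈zy∙x; xy∙z≈xz∙y; xy∙z≈x∙zy; x∙yz≈yx∙z)
import Algebra.Properties.CommutativeMonoid.Sum as CommutativeMonoidSum
open import Algebra.Properties.Group (AbelianGroup.group ℤP.+-0-abelianGroup) using (∙-cancelʳ)
open import Data.Bool using (Bool; true; false; if_then_else_)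
open import Data.Empty using (⊥; ⊥-elim)
open import Data.Fin as Fin using (Fin; zero; suc; punchOut)
open import Data.Fin.Permutation as Perm
  using (Permutation; permutation; flip; transpose; _∘ₚ_; _⟨$⟩ʳ_; _⟨$⟩ˡ_; inverseʳ)
import Data.Fin.Permutation.Components as PC
open import Data.Fin.Properties
  using (any?; all?; ¬∀⟶∃¬; punchOut-injective; injective⇒≤; suc-injective)
open import Data.Integer using (ℤ; +_; -_; _-_; _≤_; _<_)
import Data.Integer as ℤ
open import Data.Integer.Tactic.RingSolver using (solve-∀)
open import Data.List using (List; []; _∷_; length; lookup; map; allFin)
open import Data.List.Extrema ℤP.≤-totalOrder using (max; v≤max⁺; xs≤max; argmax-sel)
open import Data.List.Membership.Propositional using (_∈_; _∉_)
open import Data.List.Membership.Propositional.Properties using (∈-lookup; ∈-allFin; ∈-map⁺; ∈-map⁻)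
open import Data.List.Relation.Unary.All as All using ([]; _∷_)
open import Data.List.Relation.Unary.All.Properties.Core using (¬Any⇒All¬)
open import Data.List.Relation.Unary.Any using (here; there)
open import Data.List.Relation.Unary.Unique.Propositional using (Unique; []; _∷_)
open import Data.List.Relation.Unary.Unique.Propositional.Properties using (Unique[x∷xs]⇒x∉xs)
open import Data.Nat as ℕ using (ℕ)
import Data.Nat.Properties as ℕP
open import Data.Product using (Σ; ∃; _×_; _,_; proj₁; proj₂)
open import Data.Rational as ℚ using (ℚ)
import Data.Rational.Properties as ℚP
import Data.Rational.Unnormalised as ℚᵘ
import Data.Rational.Unnormalised.Properties as ℚᵘP
open import Data.Sum using (_⊎_; inj₁; inj₂)
open import Data.Vec.Functional using (updateAt)
open import Data.Vec.Functional.Properties using (updateAt-updates; updateAt-minimal)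
open import Function using (_∘_; _⇔_; mk⇔)
open import Function.Bundles using (Injection)
open import Function.Definitions using (Injective)
open import Function.Properties.Inverse using (↔⇒↣)
open import Relation.Binary.PropositionalEquality
open import Relation.Nullary using (yes; no)
open import Relation.Nullary.Decidable using (dec-true; dec-false)
open import Relation.Nullary.Negation using (contradiction)

toℚᵘ-toℚ : ∀ i → ℚ.toℚᵘ (toℚ i) ℚᵘ.≃ ℚᵘ.mkℚᵘ i 0
toℚᵘ-toℚ i = ℚP.toℚᵘ-fromℚᵘ (ℚᵘ.mkℚᵘ i 0)

toℚ-+ : ∀ i j → toℚ (i ℤ.+ j) ≡ toℚ i ℚ.+ toℚ j
toℚ-+ i j = ℚP.toℚᵘ-injective (begin
  ℚ.toℚᵘ (toℚ (i ℤ.+ j))                   ≈⟨ toℚᵘ-toℚ (i ℤ.+ j) ⟩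
  ℚᵘ.mkℚᵘ (i ℤ.+ j) 0                      ≈⟨ ℚᵘ.*≡* (cong₂ (λ x y → (x ℤ.+ y) ℤ.* + 1)
                                                  (sym (ℤP.*-identityʳ i)) (sym (ℤP.*-identityʳ j))) ⟩
  ℚᵘ.mkℚᵘ i 0 ℚᵘ.+ ℚᵘ.mkℚᵘ j 0             ≈⟨ ℚᵘP.+-cong (toℚᵘ-toℚ i) (toℚᵘ-toℚ j) ⟨
  ℚ.toℚᵘ (toℚ i) ℚᵘ.+ ℚ.toℚᵘ (toℚ j)       ≈⟨ ℚP.toℚᵘ-homo-+ (toℚ i) (toℚ j) ⟨
  ℚ.toℚᵘ (toℚ i ℚ.+ toℚ j)                 ∎)
  where open ℚᵘP.≃-Reasoning

toℚ-mono-≤ : ∀ {i j} → i ≤ j → toℚ i ℚ.≤ toℚ j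
toℚ-mono-≤ {i} {j} i≤j = ℚP.toℚᵘ-cancel-≤
  (ℚᵘP.≤-respˡ-≃ (ℚᵘP.≃-sym (toℚᵘ-toℚ i)) (ℚᵘP.≤-respʳ-≃ (ℚᵘP.≃-sym (toℚᵘ-toℚ j))
    (ℚᵘ.*≤* (ℤP.*-monoʳ-≤-nonNeg (+ 1) i≤j))))

toℚ-cancel-≤ : ∀ {i j} → toℚ i ℚ.≤ toℚ j → i ≤ j
toℚ-cancel-≤ {i} {j} le
  with ℚᵘ.*≤* i≤j ← ℚᵘP.≤-respˡ-≃ (toℚᵘ-toℚ i)
                      (ℚᵘP.≤-respʳ-≃ (toℚᵘ-toℚ j) (ℚP.toℚᵘ-mono-≤ le))
  = subst₂ _≤_ (ℤP.*-identityʳ i) (ℤP.*-identityʳ j) i≤j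

module ∑ℤ = CommutativeMonoidSum ℤP.+-0-commutativeMonoid
module ∑ℚ = CommutativeMonoidSum ℚP.+-0-commutativeMonoid

sumℤ≡sum : ∀ {n} (f : Fin n → ℤ) → sumℤ f ≡ ∑ℤ.sum f
sumℤ≡sum {ℕ.zero}  f = refl
sumℤ≡sum {ℕ.suc n} f = cong (ℤ._+_ (f zero)) (sumℤ≡sum (f ∘ suc))

sumℚ≡sum : ∀ {n} (f : Fin n → ℚ) → sumℚ f ≡ ∑ℚ.sum f
sumℚ≡sum {ℕ.zero}  f = refl
sumℚ≡sum {ℕ.suc n} f = cong (ℚ._+_ (f zero)) (sumℚ≡sum (f ∘ suc))

sumℤ-cong : ∀ {n} {f g : Fin n → ℤ} → (∀ x → f x ≡ g x) → sumℤ f ≡ sumℤ g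
sumℤ-cong {ℕ.zero}  f≗g = refl
sumℤ-cong {ℕ.suc n} f≗g = cong₂ ℤ._+_ (f≗g zero) (sumℤ-cong (f≗g ∘ suc))

sumℤ-+ : ∀ {n} (f g : Fin n → ℤ) → sumℤ (λ x → f x ℤ.+ g x) ≡ sumℤ f ℤ.+ sumℤ g
sumℤ-+ f g = trans (sumℤ≡sum (λ x → f x ℤ.+ g x))
  (trans (∑ℤ.∑-distrib-+ f g) (sym (cong₂ ℤ._+_ (sumℤ≡sum f) (sumℤ≡sum g))))

sumℚ-+ : ∀ {n} (f g : Fin n → ℚ) → sumℚ (λ x → f x ℚ.+ g x) ≡ sumℚ f ℚ.+ sumℚ g
sumℚ-+ f g = trans (sumℚ≡sum (λ x → f x ℚ.+ g x))
  (trans (∑ℚ.∑-distrib-+ f g) (sym (cong₂ ℚ._+_ (sumℚ≡sum f) (sumℚ≡sum g))))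

sumℤ-permute : ∀ {n} (f : Fin n → ℤ) (π : Permutation n n) → sumℤ (λ x → f (π ⟨$⟩ʳ x)) ≡ sumℤ f
sumℤ-permute f π =
  trans (sumℤ≡sum (λ x → f (π ⟨$⟩ʳ x))) (trans (sym (∑ℤ.sum-permute f π)) (sym (sumℤ≡sum f)))

sumℚ-permute : ∀ {n} (f : Fin n → ℚ) (π : Permutation n n) → sumℚ (λ x → f (π ⟨$⟩ʳ x)) ≡ sumℚ f
sumℚ-permute f π =
  trans (sumℚ≡sum (λ x → f (π ⟨$⟩ʳ x))) (trans (sym (∑ℚ.sum-permute f π)) (sym (sumℚ≡sum f)))

sumℤ-neg : ∀ {n} (f : Fin n → ℤ) → sumℤ (λ x → - f x) ≡ - sumℤ f
sumℤ-neg {ℕ.zero}  f = refl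
sumℤ-neg {ℕ.suc n} f =
  trans (cong (ℤ._+_ (- f zero)) (sumℤ-neg (f ∘ suc))) (sym (ℤP.neg-distrib-+ (f zero) _))

sumℤ-const : ∀ m k → sumℤ {m} (λ _ → + k) ≡ + (m ℕ.* k)
sumℤ-const ℕ.zero    k = refl
sumℤ-const (ℕ.suc m) k = trans (cong (ℤ._+_ (+ k)) (sumℤ-const m k)) (sym (ℤP.pos-+ k (m ℕ.* k)))

sumℤ-zero : ∀ {n} → sumℤ {n} (λ _ → + 0) ≡ + 0
sumℤ-zero {n} = trans (sumℤ-const n 0) (cong +_ (ℕP.*-zeroʳ n))

sumℤ-mono-≤ : ∀ {n} {f g : Fin n → ℤ} → (∀ x → f x ≤ g x) → sumℤ f ≤ sumℤ g
sumℤ-mono-≤ {ℕ.zero}  f≤g = ℤP.≤-refl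
sumℤ-mono-≤ {ℕ.suc n} f≤g = ℤP.+-mono-≤ (f≤g zero) (sumℤ-mono-≤ (f≤g ∘ suc))

sumℤ-mono-< : ∀ {n} {f g : Fin n → ℤ} → (∀ x → f x ≤ g x) → ∀ y → f y < g y → sumℤ f < sumℤ g
sumℤ-mono-< f≤g zero    fy<gy = ℤP.+-mono-<-≤ fy<gy (sumℤ-mono-≤ (f≤g ∘ suc))
sumℤ-mono-< f≤g (suc y) fy<gy = ℤP.+-mono-≤-< (f≤g zero) (sumℤ-mono-< (f≤g ∘ suc) y fy<gy)

sumℚ-mono-≤ : ∀ {n} {f g : Fin n → ℚ} → (∀ x → f x ℚ.≤ g x) → sumℚ f ℚ.≤ sumℚ g
sumℚ-mono-≤ {ℕ.zero}  f≤g = ℚP.≤-refl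
sumℚ-mono-≤ {ℕ.suc n} f≤g = ℚP.+-mono-≤ (f≤g zero) (sumℚ-mono-≤ (f≤g ∘ suc))

sumℚ-toℚ : ∀ {n} (f : Fin n → ℤ) → sumℚ (toℚ ∘ f) ≡ toℚ (sumℤ f)
sumℚ-toℚ {ℕ.zero}  f = refl
sumℚ-toℚ {ℕ.suc n} f =
  trans (cong (ℚ._+_ (toℚ (f zero))) (sumℚ-toℚ (f ∘ suc))) (sym (toℚ-+ (f zero) _))

sumℤ-exchange : ∀ {n} (f g : Fin n → ℤ) p → (∀ x → x ≢ p → f x ≡ g x) →
                sumℤ f ℤ.+ g p ≡ sumℤ g ℤ.+ f p
sumℤ-exchange f g zero f≈g =
  trans (cong (λ s → (f zero ℤ.+ s) ℤ.+ g zero) (sumℤ-cong (λ x → f≈g (suc x) λ ())))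
        (xy∙z≈zy∙x (f zero) (sumℤ (g ∘ suc)) (g zero))
sumℤ-exchange f g (suc p) f≈g = begin
  (f zero ℤ.+ sumℤ (f ∘ suc)) ℤ.+ g (suc p) ≡⟨ ℤP.+-assoc (f zero) _ _ ⟩
  f zero ℤ.+ (sumℤ (f ∘ suc) ℤ.+ g (suc p)) ≡⟨ cong₂ ℤ._+_ (f≈g zero λ ())
                                                 (sumℤ-exchange (f ∘ suc) (g ∘ suc) p
                                                   (λ x x≢p → f≈g (suc x) (x≢p ∘ suc-injective))) ⟩
  g zero ℤ.+ (sumℤ (g ∘ suc) ℤ.+ f (suc p)) ≡⟨ ℤP.+-assoc (g zero) _ _ ⟨
  (g zero ℤ.+ sumℤ (g ∘ suc)) ℤ.+ f (suc p) ∎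
  where open ≡-Reasoning

sumℤ-exchange₂ : ∀ {n} (f g : Fin n → ℤ) p q → q ≢ p → (∀ x → x ≢ p → x ≢ q → f x ≡ g x) →
                 sumℤ f ℤ.+ (g p ℤ.+ g q) ≡ sumℤ g ℤ.+ (f p ℤ.+ f q)
sumℤ-exchange₂ {n} f g p q q≢p f≈g = begin
  sumℤ f ℤ.+ (g p ℤ.+ g q)   ≡⟨ ℤP.+-assoc (sumℤ f) (g p) (g q) ⟨
  (sumℤ f ℤ.+ g p) ℤ.+ g q   ≡⟨ cong (λ x → (sumℤ f ℤ.+ x) ℤ.+ g q) hp ⟨
  (sumℤ f ℤ.+ h p) ℤ.+ g q   ≡⟨ cong (ℤ._+ g q) (sumℤ-exchange f h p
                                  (λ x x≢p → sym (updateAt-minimal x p f x≢p))) ⟩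
  (sumℤ h ℤ.+ f p) ℤ.+ g q   ≡⟨ xy∙z≈xz∙y (sumℤ h) (f p) (g q) ⟩
  (sumℤ h ℤ.+ g q) ℤ.+ f p   ≡⟨ cong (ℤ._+ f p) (sumℤ-exchange h g q h≈g) ⟩
  (sumℤ g ℤ.+ h q) ℤ.+ f p   ≡⟨ cong (λ x → (sumℤ g ℤ.+ x) ℤ.+ f p) (updateAt-minimal q p f q≢p) ⟩
  (sumℤ g ℤ.+ f q) ℤ.+ f p   ≡⟨ xy∙z≈x∙zy (sumℤ g) (f q) (f p) ⟩
  sumℤ g ℤ.+ (f p ℤ.+ f q)   ∎
  where
  open ≡-Reasoning
  h : Fin n → ℤ
  h = updateAt f p (λ _ → g p)
  hp : h p ≡ g p
  hp = updateAt-updates p f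
  h≈g : ∀ x → x ≢ q → h x ≡ g x
  h≈g x x≢q with x Fin.≟ p
  ... | yes refl = hp
  ... | no x≢p   = trans (updateAt-minimal x p f x≢p) (f≈g x x≢p x≢q)

indicator : Bool → ℤ
indicator b = + (if b then 1 else 0)

count≡sumℤ : ∀ {n} (p : Fin n → Bool) → + count p ≡ sumℤ (indicator ∘ p)
count≡sumℤ {ℕ.zero}  p = refl
count≡sumℤ {ℕ.suc n} p = trans (ℤP.pos-+ (if p zero then 1 else 0) (count (p ∘ suc)))
                               (cong (ℤ._+_ (indicator (p zero))) (count≡sumℤ (p ∘ suc)))

-- wt pr M a b is definitionally sign (pr a b (M a)) (pr a (M a) b).
sign : Bool → Bool → ℤ
sign p q = if p then + 1 else if q then - + 1 else + 0

sign≡indicator-difference : ∀ p q → (p ≡ true → q ≡ true → ⊥) → sign p q ≡ indicator p - indicator q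
sign≡indicator-difference true  true  p∧q = ⊥-elim (p∧q refl refl)
sign≡indicator-difference true  false _   = refl
sign≡indicator-difference false true  _   = refl
sign≡indicator-difference false false _   = refl

sumℤ-sign : ∀ {n} (p q : Fin n → Bool) → (∀ x → p x ≡ true → q x ≡ true → ⊥) →
            sumℤ (λ x → sign (p x) (q x)) ≡ + count p - + count q
sumℤ-sign p q disjoint = begin
  sumℤ (λ x → sign (p x) (q x))
    ≡⟨ sumℤ-cong (λ x → sign≡indicator-difference (p x) (q x) (disjoint x)) ⟩
  sumℤ (λ x → indicator (p x) - indicator (q x))
    ≡⟨ sumℤ-+ (indicator ∘ p) (λ x → - indicator (q x)) ⟩
  sumℤ (indicator ∘ p) ℤ.+ sumℤ (λ x → - indicator (q x))
    ≡⟨ cong (ℤ._+_ (sumℤ (indicator ∘ p))) (sumℤ-neg (indicator ∘ q)) ⟩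
  sumℤ (indicator ∘ p) - sumℤ (indicator ∘ q)
    ≡⟨ cong₂ _-_ (count≡sumℤ p) (count≡sumℤ q) ⟨
  + count p - + count q
    ∎
  where open ≡-Reasoning

i+j≤k⇒i≤k-j : ∀ {i j k} → i ℤ.+ j ≤ k → i ≤ k - j
i+j≤k⇒i≤k-j {i} {j} {k} i+j≤k = subst (_≤ k - j) i+j-j≡i (ℤP.+-monoˡ-≤ (- j) i+j≤k)
  where
  i+j-j≡i : i ℤ.+ j - j ≡ i
  i+j-j≡i = trans (ℤP.+-assoc i j (- j)) (trans (cong (ℤ._+_ i) (ℤP.+-inverseʳ j)) (ℤP.+-identityʳ i))

sign≤1 : ∀ p q → sign p q ≤ + 1
sign≤1 true  _     = ℤP.≤-refl
sign≤1 false true  = ℤ.-≤+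
sign≤1 false false = ℤ.+≤+ ℕ.z≤n

injective⇒surjective : ∀ {n} {f : Fin n → Fin n} → Injective _≡_ _≡_ f → ∀ y → ∃ λ x → f x ≡ y
injective⇒surjective {ℕ.zero} inj ()
injective⇒surjective {ℕ.suc m} {f} inj y with any? (λ x → f x Fin.≟ y)
... | yes found = found
... | no ¬found = contradiction (injective⇒≤ punched-injective) ℕP.1+n≰n
  where
  missed : ∀ x → y ≢ f x
  missed x y≡fx = ¬found (x , sym y≡fx)
  punched-injective : Injective _≡_ _≡_ (λ x → punchOut (missed x))
  punched-injective {x} {x′} eq = inj (punchOut-injective (missed x) (missed x′) eq)

injective⇒permutation : ∀ {n} (f : Fin n → Fin n) → Injective _≡_ _≡_ f → Permutation n n
injective⇒permutation {n} f inj = permutation f f⁻¹ f∘f⁻¹ (λ x → inj (f∘f⁻¹ (f x)))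
  where
  f⁻¹ : Fin n → Fin n
  f⁻¹ y = proj₁ (injective⇒surjective inj y)
  f∘f⁻¹ : ∀ y → f (f⁻¹ y) ≡ y
  f∘f⁻¹ y = proj₂ (injective⇒surjective inj y)

permutation-injective : ∀ {n} (π : Permutation n n) → Injective _≡_ _≡_ (π ⟨$⟩ʳ_)
permutation-injective π = Injection.injective (↔⇒↣ π)

transpose-matchˡ : ∀ {n} (i j : Fin n) → PC.transpose i j i ≡ j
transpose-matchˡ i j rewrite dec-true (i Fin.≟ i) refl = refl

transpose-matchʳ : ∀ {n} (i j : Fin n) → PC.transpose i j j ≡ i
transpose-matchʳ i j with j Fin.≟ i
... | yes j≡i = j≡i
... | no  j≢i rewrite dec-true (j Fin.≟ j) refl = refl

transpose-other : ∀ {n} {i j k : Fin n} → k ≢ i → k ≢ j → PC.transpose i j k ≡ k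
transpose-other {i = i} {j} {k} k≢i k≢j
  rewrite dec-false (k Fin.≟ i) k≢i | dec-false (k Fin.≟ j) k≢j = refl

unique-lookup-injective : ∀ {A : Set} {xs : List A} → Unique xs → Injective _≡_ _≡_ (lookup xs)
unique-lookup-injective (_ ∷ _)   {zero}  {zero}  _  = refl
unique-lookup-injective (x≢ ∷ _)  {zero}  {suc j} eq = contradiction eq (All.lookup x≢ (∈-lookup j))
unique-lookup-injective (x≢ ∷ _)  {suc i} {zero}  eq = contradiction (sym eq) (All.lookup x≢ (∈-lookup i))
unique-lookup-injective (_ ∷ xs!) {suc i} {suc j} eq = cong suc (unique-lookup-injective xs! eq)

unique⇒length≤ : ∀ {n} {xs : List (Fin n)} → Unique xs → length xs ℕ.≤ n
unique⇒length≤ xs! = injective⇒≤ (unique-lookup-injective xs!)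

module Digraph {n : ℕ} (Arc : Fin n → Fin n → Bool) (W : Fin n → Fin n → ℤ) where

  open import Data.List.Membership.DecPropositional (Fin._≟_ {n}) using (_∈?_)

  infixr 5 _∷⟨_⟩_
  data Path : Fin n → Fin n → Set where
    [_]    : ∀ a → Path a a
    _∷⟨_⟩_ : ∀ a {c e} → Arc a c ≡ true → Path c e → Path a e

  vertices : ∀ {a e} → Path a e → List (Fin n)
  vertices [ a ]        = a ∷ []
  vertices (a ∷⟨ _ ⟩ p) = a ∷ vertices p

  weight : ∀ {a e} → Path a e → ℤ
  weight [ a ]              = + 0
  weight (_∷⟨_⟩_ a {c} _ p) = W a c ℤ.+ weight p

  Simple : ∀ {a e} → Path a e → Set
  Simple p = Unique (vertices p)

  first∈ : ∀ {a e} (p : Path a e) → a ∈ vertices p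
  first∈ [ a ]        = here refl
  first∈ (a ∷⟨ _ ⟩ p) = here refl

  last∈ : ∀ {a e} (p : Path a e) → e ∈ vertices p
  last∈ [ a ]        = here refl
  last∈ (a ∷⟨ _ ⟩ p) = there (last∈ p)

  weight<length : (∀ a c → W a c ≤ + 1) → ∀ {a e} (p : Path a e) → weight p < + length (vertices p)
  weight<length W≤1 [ a ]              = ℤ.+<+ (ℕ.s≤s ℕ.z≤n)
  weight<length W≤1 (_∷⟨_⟩_ a {c} _ p) = subst (W a c ℤ.+ weight p <_) (sym (ℤP.pos-+ 1 (length (vertices p))))
                                                (ℤP.+-mono-≤-< (W≤1 a c) (weight<length W≤1 p))

  simple-weight<n : (∀ a c → W a c ≤ + 1) → ∀ {a e} (p : Path a e) → Simple p → weight p < + n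
  simple-weight<n W≤1 p p! = ℤP.<-≤-trans (weight<length W≤1 p) (ℤ.+≤+ (unique⇒length≤ p!))

  -- The cyclic shift along p: each vertex of p goes to the next one, the last vertex back to
  -- the first, and every vertex off p is fixed.
  rotation : ∀ {a e} → Path a e → Permutation n n
  rotation [ a ]              = Perm.id
  rotation (_∷⟨_⟩_ a {c} _ p) = rotation p ∘ₚ transpose a c

  rotation-outside : ∀ {a e} (p : Path a e) {x} → x ∉ vertices p → rotation p ⟨$⟩ʳ x ≡ x
  rotation-outside [ a ]                    x∉ = refl
  rotation-outside (_∷⟨_⟩_ a {c} _ p) {x} x∉ =
    trans (cong (PC.transpose a c) (rotation-outside p (x∉ ∘ there)))
          (transpose-other (x∉ ∘ here) (λ { refl → x∉ (there (first∈ p)) }))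

  rotation-last : ∀ {a e} (p : Path a e) → rotation p ⟨$⟩ʳ e ≡ a
  rotation-last [ a ]              = refl
  rotation-last (_∷⟨_⟩_ a {c} _ p) = trans (cong (PC.transpose a c) (rotation-last p)) (transpose-matchʳ a c)

  module _ {a c e} (arc : Arc a c ≡ true) (p : Path c e) (a∉p : a ∉ vertices p) where

    rotation-first : rotation (a ∷⟨ arc ⟩ p) ⟨$⟩ʳ a ≡ c
    rotation-first = trans (cong (PC.transpose a c) (rotation-outside p a∉p)) (transpose-matchˡ a c)

    rotation-middle : ∀ {x} → x ≢ a → x ≢ e → rotation (a ∷⟨ arc ⟩ p) ⟨$⟩ʳ x ≡ rotation p ⟨$⟩ʳ x
    rotation-middle x≢a x≢e = transpose-other
      (λ px≡a → x≢a (permutation-injective (rotation p) (trans px≡a (sym (rotation-outside p a∉p)))))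
      (λ px≡c → x≢e (permutation-injective (rotation p) (trans px≡c (sym (rotation-last p)))))

  CycleCover : Permutation n n → Set
  CycleCover σ = ∀ x → Arc x (σ ⟨$⟩ʳ x) ≡ true

  coverWeight : Permutation n n → ℤ
  coverWeight σ = sumℤ (λ x → W x (σ ⟨$⟩ʳ x))

  NoPositiveSimpleCycle : Set
  NoPositiveSimpleCycle = ∀ {a e} (p : Path a e) → Simple p → Arc e a ≡ true → weight p ℤ.+ W e a ≤ + 0

  module _ (loop : ∀ x → Arc x x ≡ true) (loop-weight : ∀ x → W x x ≡ + 0) where

    rotation-follows-arcs : ∀ {a e} (p : Path a e) → Simple p →
                            ∀ x → x ≢ e → Arc x (rotation p ⟨$⟩ʳ x) ≡ true
    rotation-follows-arcs [ a ] _ x _ = loop x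
    rotation-follows-arcs (a ∷⟨ arc ⟩ p) a∷p!@(_ ∷ p!) x x≢e with x Fin.≟ a
    ... | yes refl = subst (λ y → Arc x y ≡ true) (sym (rotation-first arc p (Unique[x∷xs]⇒x∉xs a∷p!))) arc
    ... | no  x≢a  = subst (λ y → Arc x y ≡ true)
                           (sym (rotation-middle arc p (Unique[x∷xs]⇒x∉xs a∷p!) x≢a x≢e))
                           (rotation-follows-arcs p p! x x≢e)

    rotation-weight : ∀ {a e} (p : Path a e) → Simple p →
                      sumℤ (λ x → W x (rotation p ⟨$⟩ʳ x)) ≡ weight p ℤ.+ W e a
    rotation-weight [ a ] _ = begin
      sumℤ (λ x → W x x) ≡⟨ trans (sumℤ-cong loop-weight) (sumℤ-zero {n}) ⟩
      + 0                ≡⟨ trans (ℤP.+-identityˡ (W a a)) (loop-weight a) ⟨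
      + 0 ℤ.+ W a a      ∎
      where open ≡-Reasoning
    rotation-weight (_∷⟨_⟩_ a {c} {e} arc p) a∷p!@(_ ∷ p!) = ∙-cancelʳ (W e c) _ _ (begin
      sumℤ f ℤ.+ W e c
        ≡⟨ cong (ℤ._+_ (sumℤ f)) (ℤP.+-identityˡ (W e c)) ⟨
      sumℤ f ℤ.+ (+ 0 ℤ.+ W e c)
        ≡⟨ cong (ℤ._+_ (sumℤ f)) (cong₂ ℤ._+_ g[a]≡0 g[e]≡W[e,c]) ⟨
      sumℤ f ℤ.+ (g a ℤ.+ g e)
        ≡⟨ sumℤ-exchange₂ f g a e e≢a (λ x x≢a x≢e → cong (W x) (rotation-middle arc p a∉p x≢a x≢e)) ⟩
      sumℤ g ℤ.+ (f a ℤ.+ f e)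
        ≡⟨ cong₂ ℤ._+_ (rotation-weight p p!) (cong₂ ℤ._+_ (cong (W a) (rotation-first arc p a∉p))
                                                            (cong (W e) (rotation-last (a ∷⟨ arc ⟩ p)))) ⟩
      (weight p ℤ.+ W e c) ℤ.+ (W a c ℤ.+ W e a)
        ≡⟨ regroup (weight p) (W e c) (W a c) (W e a) ⟩
      ((W a c ℤ.+ weight p) ℤ.+ W e a) ℤ.+ W e c
        ∎)
      where
      open ≡-Reasoning
      a∉p : a ∉ vertices p
      a∉p = Unique[x∷xs]⇒x∉xs a∷p!
      e≢a : e ≢ a
      e≢a refl = a∉p (last∈ p)
      f g : Fin n → ℤ
      f x = W x (rotation (a ∷⟨ arc ⟩ p) ⟨$⟩ʳ x)
      g x = W x (rotation p ⟨$⟩ʳ x)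
      g[a]≡0 : g a ≡ + 0
      g[a]≡0 = trans (cong (W a) (rotation-outside p a∉p)) (loop-weight a)
      g[e]≡W[e,c] : g e ≡ W e c
      g[e]≡W[e,c] = cong (W e) (rotation-last p)
      regroup : ∀ w x y z → (w ℤ.+ x) ℤ.+ (y ℤ.+ z) ≡ ((y ℤ.+ w) ℤ.+ z) ℤ.+ x
      regroup = solve-∀

    coverWeight≤0⇒noPositiveSimpleCycle : (∀ σ → CycleCover σ → coverWeight σ ≤ + 0) → NoPositiveSimpleCycle
    coverWeight≤0⇒noPositiveSimpleCycle covers≤0 {a} {e} p p! closing =
      subst (_≤ + 0) (rotation-weight p p!) (covers≤0 (rotation p) rotation-covers)
      where
      rotation-covers : CycleCover (rotation p)
      rotation-covers x with x Fin.≟ e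
      ... | yes refl = subst (λ y → Arc x y ≡ true) (sym (rotation-last p)) closing
      ... | no  x≢e  = rotation-follows-arcs p p! x x≢e

  record Split {c e} (p : Path c e) (a : Fin n) : Set where
    field
      prefix        : Path c a
      suffix        : Path a e
      weight-split  : weight p ≡ weight prefix ℤ.+ weight suffix
      prefix⊆       : ∀ {x} → x ∈ vertices prefix → x ∈ vertices p
      prefix-simple : Simple prefix
      suffix-simple : Simple suffix

  split : ∀ {c e} (p : Path c e) → Simple p → ∀ {a} → a ∈ vertices p → Split p a
  split [ c ] p! (here refl) = record
    { prefix = [ c ] ; suffix = [ c ] ; weight-split = refl
    ; prefix⊆ = λ x∈ → x∈ ; prefix-simple = p! ; suffix-simple = p! }
  split (c ∷⟨ arc ⟩ p) p! (here refl) = record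
    { prefix = [ c ] ; suffix = c ∷⟨ arc ⟩ p ; weight-split = sym (ℤP.+-identityˡ _)
    ; prefix⊆ = λ { (here refl) → here refl } ; prefix-simple = [] ∷ [] ; suffix-simple = p! }
  split (_∷⟨_⟩_ c {c′} arc p) (c≢ ∷ p!) (there a∈p) = record
    { prefix = c ∷⟨ arc ⟩ prefix ; suffix = suffix
    ; weight-split = trans (cong (ℤ._+_ (W c c′)) weight-split) (sym (ℤP.+-assoc (W c c′) _ _))
    ; prefix⊆ = λ { (here refl) → here refl ; (there x∈) → there (prefix⊆ x∈) }
    ; prefix-simple = All.tabulate (All.lookup c≢ ∘ prefix⊆) ∷ prefix-simple
    ; suffix-simple = suffix-simple }
    where open Split (split p p! a∈p)

  record SimplePathFrom (a : Fin n) : Set where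
    field
      {end}  : Fin n
      path   : Path a end
      simple : Simple path
  open SimplePathFrom

  prepend : NoPositiveSimpleCycle → ∀ {a c} → Arc a c ≡ true → (p : SimplePathFrom c) →
            Σ (SimplePathFrom a) λ q → W a c ℤ.+ weight (path p) ≤ weight (path q)
  prepend no-cycle {a} {c} arc p with a ∈? vertices (path p)
  ... | no  a∉p =
    record { path = a ∷⟨ arc ⟩ path p ; simple = ¬Any⇒All¬ _ a∉p ∷ simple p } , ℤP.≤-refl
  ... | yes a∈p = record { path = suffix ; simple = suffix-simple } , (begin
    W a c ℤ.+ weight (path p)                        ≡⟨ cong (ℤ._+_ (W a c)) weight-split ⟩
    W a c ℤ.+ (weight prefix ℤ.+ weight suffix)      ≡⟨ x∙yz≈yx∙z (W a c) (weight prefix) (weight suffix) ⟩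
    (weight prefix ℤ.+ W a c) ℤ.+ weight suffix      ≤⟨ ℤP.+-monoˡ-≤ (weight suffix)
                                                          (no-cycle prefix prefix-simple arc) ⟩
    + 0 ℤ.+ weight suffix                            ≡⟨ ℤP.+-identityˡ (weight suffix) ⟩
    weight suffix                                    ∎)
    where
    open Split (split (path p) (simple p) a∈p)
    open ℤP.≤-Reasoning

  gain : (Fin n → ℤ) → Fin n → Fin n → ℤ
  gain h a c = if Arc a c then W a c ℤ.+ h c else h a

  relax : (Fin n → ℤ) → Fin n → ℤ
  relax h a = max (h a) (map (gain h a) (allFin n))

  relax-≥ : ∀ h a → h a ≤ relax h a
  relax-≥ h a = v≤max⁺ (h a) (map (gain h a) (allFin n)) (inj₁ ℤP.≤-refl)

  relax-arc : ∀ h {a c} → Arc a c ≡ true → W a c ℤ.+ h c ≤ relax h a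
  relax-arc h {a} {c} arc = subst (_≤ relax h a) (cong (λ b → if b then W a c ℤ.+ h c else h a) arc)
    (All.lookup (xs≤max (h a) (map (gain h a) (allFin n))) (∈-map⁺ (gain h a) (∈-allFin c)))

  relax-attained : ∀ h a → relax h a ≡ h a ⊎ ∃ λ c → Arc a c ≡ true × relax h a ≡ W a c ℤ.+ h c
  relax-attained h a with argmax-sel (λ x → x) (h a) (map (gain h a) (allFin n))
  ... | inj₁ relax≡h = inj₁ relax≡h
  ... | inj₂ relax∈ with ∈-map⁻ (gain h a) relax∈
  ...   | c , _ , relax≡gain with Arc a c in arc
  ...     | true  = inj₂ (c , arc , relax≡gain)
  ...     | false = inj₁ relax≡gain

  relaxed : ℕ → Fin n → ℤ
  relaxed ℕ.zero    _ = + 0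
  relaxed (ℕ.suc k)   = relax (relaxed k)

  relaxed-nonneg : ∀ k a → + 0 ≤ relaxed k a
  relaxed-nonneg ℕ.zero    a = ℤP.≤-refl
  relaxed-nonneg (ℕ.suc k) a = ℤP.≤-trans (relaxed-nonneg k a) (relax-≥ (relaxed k) a)

  relaxed≤simple-path : NoPositiveSimpleCycle →
                        ∀ k a → Σ (SimplePathFrom a) λ q → relaxed k a ≤ weight (path q)
  relaxed≤simple-path no-cycle ℕ.zero a = record { path = [ a ] ; simple = [] ∷ [] } , ℤP.≤-refl
  relaxed≤simple-path no-cycle (ℕ.suc k) a with relax-attained (relaxed k) a
  ... | inj₁ unchanged =
    let q , k≤q = relaxed≤simple-path no-cycle k a
    in  q , subst (_≤ weight (path q)) (sym unchanged) k≤q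
  ... | inj₂ (c , arc , via-c) =
    let q , k≤q = relaxed≤simple-path no-cycle k c
        q′ , q≤q′ = prepend no-cycle arc q
    in  q′ , subst (_≤ weight (path q′)) (sym via-c) (ℤP.≤-trans (ℤP.+-monoʳ-≤ (W a c) k≤q) q≤q′)

  module _ (W≤1 : ∀ a c → W a c ≤ + 1) (no-cycle : NoPositiveSimpleCycle) where

    relaxed<n : ∀ k a → relaxed k a < + n
    relaxed<n k a = let q , k≤q = relaxed≤simple-path no-cycle k a
                    in  ℤP.≤-<-trans k≤q (simple-weight<n W≤1 (path q) (simple q))

    Stable : ℕ → Set
    Stable k = ∀ a → relax (relaxed k) a ≡ relaxed k a

    stable-or-growing : ∀ k → ∃ Stable ⊎ + k ≤ sumℤ (relaxed k)
    stable-or-growing ℕ.zero = inj₂ (ℤP.≤-reflexive (sym (sumℤ-zero {n})))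
    stable-or-growing (ℕ.suc k) with stable-or-growing k
    ... | inj₁ stable = inj₁ stable
    ... | inj₂ k≤sum with all? (λ a → relax (relaxed k) a ℤ.≟ relaxed k a)
    ...   | yes stable = inj₁ (k , stable)
    ...   | no ¬stable with ¬∀⟶∃¬ n _ (λ a → relax (relaxed k) a ℤ.≟ relaxed k a) ¬stable
    ...     | a , moved = inj₂ (ℤP.i<j⇒suc[i]≤j (ℤP.≤-<-trans k≤sum
                (sumℤ-mono-< (relax-≥ (relaxed k)) a (ℤP.≤∧≢⇒< (relax-≥ (relaxed k) a) (moved ∘ sym)))))

    stabilises : ∃ Stable
    stabilises with stable-or-growing (ℕ.suc (n ℕ.* n))
    ... | inj₁ stable = stable
    ... | inj₂ n²<sum = contradiction (ℤP.≤-trans n²<sum sum≤n²) (ℤP.<⇒≱ (ℤ.+<+ (ℕP.n<1+n (n ℕ.* n))))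
      where
      sum≤n² : sumℤ (relaxed (ℕ.suc (n ℕ.* n))) ≤ + (n ℕ.* n)
      sum≤n² = ℤP.≤-trans (sumℤ-mono-≤ (ℤP.<⇒≤ ∘ relaxed<n (ℕ.suc (n ℕ.* n))))
                          (ℤP.≤-reflexive (sumℤ-const n n))

    bounded-potential : Σ (Fin n → ℤ) λ h → (∀ a → + 0 ≤ h a × h a < + n) ×
                                    (∀ {a c} → Arc a c ≡ true → W a c ℤ.+ h c ≤ h a)
    bounded-potential =
      let k , stable = stabilises
      in  relaxed k
        , (λ a → relaxed-nonneg k a , relaxed<n k a)
        , λ {a} {c} arc → subst (W a c ℤ.+ relaxed k c ≤_) (stable a) (relax-arc (relaxed k) arc)

LP2Objective-toℚ : ∀ {n} (xA xB : Fin n → ℤ) →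
                   LP2Objective (toℚ ∘ xA) (toℚ ∘ xB) ≡ toℚ (sumℤ xA ℤ.+ sumℤ xB)
LP2Objective-toℚ xA xB =
  trans (cong₂ ℚ._+_ (sumℚ-toℚ xA) (sumℚ-toℚ xB)) (sym (toℚ-+ (sumℤ xA) (sumℤ xB)))

weak-duality : ∀ {n} {E : Graph n} {yA yB} pr (M N : Fin n → Fin n) →
               LP2Feasible E pr M yA yB → IsPerfectMatching E N →
               toℚ (sumℤ (λ a → wt pr M a (N a))) ℚ.≤ LP2Objective yA yB
weak-duality {yA = yA} {yB} pr M N feasible N-perfect = begin
  toℚ (sumℤ (λ a → wt pr M a (N a))) ≡⟨ sumℚ-toℚ (λ a → wt pr M a (N a)) ⟨
  sumℚ (λ a → toℚ (wt pr M a (N a))) ≤⟨ sumℚ-mono-≤ (λ a → feasible a (N a) (edges a)) ⟩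
  sumℚ (λ a → yA a ℚ.+ yB (N a))     ≡⟨ sumℚ-+ yA (yB ∘ N) ⟩
  sumℚ yA ℚ.+ sumℚ (yB ∘ N)          ≡⟨ cong (ℚ._+_ (sumℚ yA))
                                          (sumℚ-permute yB (injective⇒permutation N injective)) ⟩
  LP2Objective yA yB                 ∎
  where
  open ℚP.≤-Reasoning
  open IsPerfectMatching N-perfect

module _ {n : ℕ} {E : Graph n} {pr : Pref n} (prefs : IsPrefSystem E pr) where
  open IsPrefSystem prefs using (irrefl) renaming (trans to ≻-trans)

  ≻-asym : ∀ a b b′ → pr a b b′ ≡ true → pr a b′ b ≡ true → ⊥
  ≻-asym a b b′ b≻b′ b′≻b with () ← trans (sym (≻-trans a b b′ b b≻b′ b′≻b)) (irrefl a b)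

  wt-self : (M : Fin n → Fin n) → ∀ a → wt pr M a (M a) ≡ + 0
  wt-self M a rewrite irrefl a (M a) = refl

  sumℤ-wt≡-Δ : (M N : Fin n → Fin n) → sumℤ (λ a → wt pr M a (N a)) ≡ - Δ pr M N
  sumℤ-wt≡-Δ M N =
    trans (sumℤ-sign (λ a → pr a (N a) (M a)) (λ a → pr a (M a) (N a)) (λ a → ≻-asym a (N a) (M a)))
          (minus-swap (φ pr N M) (φ pr M N))
    where
    minus-swap : ∀ i j → + i - + j ≡ - (+ j - + i)
    minus-swap i j = trans (ℤP.[+m]-[+n]≡m⊖n i j)
                     (trans (ℤP.⊖-swap i j) (cong -_ (sym (ℤP.[+m]-[+n]≡m⊖n j i))))

  module _ {M : Fin n → Fin n} (M-perfect : IsPerfectMatching E M) where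

    LP2Objective-nonneg : ∀ {yA yB} → LP2Feasible E pr M yA yB → ℚ.0ℚ ℚ.≤ LP2Objective yA yB
    LP2Objective-nonneg {yA} {yB} feasible =
      subst (ℚ._≤ LP2Objective yA yB) (cong toℚ (trans (sumℤ-cong (wt-self M)) (sumℤ-zero {n})))
            (weak-duality pr M M feasible M-perfect)

    zero-objective⇒optimal : ∀ {yA yB} → LP2Feasible E pr M yA yB → LP2Objective yA yB ≡ ℚ.0ℚ →
                             LP2Optimal E pr M yA yB
    zero-objective⇒optimal feasible obj≡0 =
      feasible , λ zA zB z-feasible → subst (ℚ._≤ LP2Objective zA zB) (sym obj≡0) (LP2Objective-nonneg z-feasible)

    feasible-nonpositive⇒popular : ∀ {yA yB} → LP2Feasible E pr M yA yB → LP2Objective yA yB ℚ.≤ ℚ.0ℚ →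
                             IsPopular E pr M
    feasible-nonpositive⇒popular feasible obj≤0 = M-perfect , Δ-nonneg
      where
      Δ-nonneg : ∀ N → IsPerfectMatching E N → + 0 ≤ Δ pr M N
      Δ-nonneg N N-perfect = subst (+ 0 ≤_) (ℤP.neg-involutive (Δ pr M N)) (ℤP.neg-mono-≤
        (subst (_≤ + 0) (sumℤ-wt≡-Δ M N)
          (toℚ-cancel-≤ (ℚP.≤-trans (weak-duality pr M N feasible N-perfect) obj≤0))))

module _ {n : ℕ} {E : Graph n} {pr : Pref n} (prefs : IsPrefSystem E pr)
         {M : Fin n → Fin n} (M-perfect : IsPerfectMatching E M) where
  open IsPerfectMatching M-perfect renaming (injective to M-injective; edges to M-edges)

  open Digraph (λ a c → E a (M c)) (λ a c → wt pr M a (M c))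

  popular⇒coverWeight≤0 : IsPopular E pr M → ∀ σ → CycleCover σ → coverWeight σ ≤ + 0
  popular⇒coverWeight≤0 (_ , Δ-nonneg) σ cover =
    subst (_≤ + 0) (sym (sumℤ-wt≡-Δ prefs M N)) (ℤP.neg-mono-≤ (Δ-nonneg N N-perfect))
    where
    N : Fin n → Fin n
    N = M ∘ (σ ⟨$⟩ʳ_)
    N-perfect : IsPerfectMatching E N
    N-perfect = record { injective = permutation-injective σ ∘ M-injective ; edges = cover }

  popular⇒exchange-potential : IsPopular E pr M →
    Σ (Fin n → ℤ) λ h → (∀ a → + 0 ≤ h a × h a < + n) ×
                        (∀ {a c} → E a (M c) ≡ true → wt pr M a (M c) ≤ h a - h c)
  popular⇒exchange-potential popular =
    let no-cycle = coverWeight≤0⇒noPositiveSimpleCycle M-edges (wt-self prefs M) (popular⇒coverWeight≤0 popular)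
        h , bounds , tight = bounded-potential (λ a c → sign≤1 (pr a (M c) (M a)) (pr a (M a) (M c))) no-cycle
    in  h , bounds , i+j≤k⇒i≤k-j ∘ tight

  private
    π : Permutation n n
    π = injective⇒permutation M M-injective

  M⁻¹ : Fin n → Fin n
  M⁻¹ = π ⟨$⟩ˡ_

  sumℤ-neg∘M⁻¹ : (h : Fin n → ℤ) → sumℤ h ℤ.+ sumℤ (λ b → - h (M⁻¹ b)) ≡ + 0
  sumℤ-neg∘M⁻¹ h =
    trans (cong (ℤ._+_ (sumℤ h)) (trans (sumℤ-neg (h ∘ M⁻¹)) (cong -_ (sumℤ-permute h (flip π)))))
          (ℤP.+-inverseʳ (sumℤ h))

  potential⇒feasible : ∀ h → (∀ {a c} → E a (M c) ≡ true → wt pr M a (M c) ≤ h a - h c) →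
                       LP2Feasible E pr M (toℚ ∘ h) (λ b → toℚ (- h (M⁻¹ b)))
  potential⇒feasible h tight a b edge =
    subst (toℚ (wt pr M a b) ℚ.≤_) (toℚ-+ (h a) (- h (M⁻¹ b))) (toℚ-mono-≤ (feasibleℤ b edge))
    where
    feasibleℤ : ∀ b → E a b ≡ true → wt pr M a b ≤ h a - h (M⁻¹ b)
    feasibleℤ b = subst (λ b → E a b ≡ true → wt pr M a b ≤ h a - h (M⁻¹ b)) (inverseʳ π)
      (λ edge → subst (λ c → wt pr M a (M (M⁻¹ b)) ≤ h a - h c) (sym (Perm.inverseˡ π)) (tight edge))

  popular⇒integral-dual : IsPopular E pr M →
    Σ (Fin n → ℤ) λ αA → Σ (Fin n → ℤ) λ αB →
      LP2Optimal E pr M (toℚ ∘ αA) (toℚ ∘ αB) ×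
      (∀ a → (+ 0 ≤ αA a) × (αA a < + n)) ×
      (∀ b → (- (+ n) < αB b) × (αB b ≤ + 0)) ×
      (sumℤ αA ℤ.+ sumℤ αB ≡ + 0)
  popular⇒integral-dual popular =
    let h , bounds , tight = popular⇒exchange-potential popular
        αB = λ b → - h (M⁻¹ b)
    in  h , αB
      , zero-objective⇒optimal prefs M-perfect (potential⇒feasible h tight)
                                (trans (LP2Objective-toℚ h αB) (cong toℚ (sumℤ-neg∘M⁻¹ h)))
      , bounds
      , (λ b → ℤP.neg-mono-< (proj₂ (bounds (M⁻¹ b))) , ℤP.neg-mono-≤ (proj₁ (bounds (M⁻¹ b))))
      , sumℤ-neg∘M⁻¹ h

  integral-dual⇒popular : ∀ {αA αB} → LP2Feasible E pr M (toℚ ∘ αA) (toℚ ∘ αB) →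
                          sumℤ αA ℤ.+ sumℤ αB ≡ + 0 → IsPopular E pr M
  integral-dual⇒popular {αA} {αB} feasible sum≡0 =
    feasible-nonpositive⇒popular prefs M-perfect feasible
      (ℚP.≤-reflexive (trans (LP2Objective-toℚ αA αB) (cong toℚ sum≡0)))

theorem7 : (n : ℕ) (E : Graph n) (pr : Pref n) → IsPrefSystem E pr →
    (M : Fin n → Fin n) → IsPerfectMatching E M →
    IsPopular E pr M ⇔
      Σ (Fin n → ℤ) (λ αA → Σ (Fin n → ℤ) (λ αB →
        LP2Optimal E pr M (λ a → toℚ (αA a)) (λ b → toℚ (αB b)) ×
        (∀ a → (+ 0 ≤ αA a) × (αA a < + n)) ×
        (∀ b → (- (+ n) < αB b) × (αB b ≤ + 0)) ×
        (sumℤ αA Data.Integer.+ sumℤ αB ≡ + 0)))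
theorem7 n E pr prefs M M-perfect = mk⇔
  (popular⇒integral-dual prefs M-perfect)
  (λ (_ , _ , (feasible , _) , _ , _ , sum≡0) → integral-dual⇒popular prefs M-perfect feasible sum≡0)
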